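{- Let $s > r \ge 2$ be fixed integers. For each $n$, let $G=(V,E)$ be an $n$-vertex strongly $K_s$-saturated graph whose number of copies of $K_r$ equals $\mathrm{ssat}(n,K_r,K_s)$. Let $E_1$ be the set of edges of $G$ contained in at least one copy of $K_r$, let $G_1 = (V,E_1)$, let $A = \{v \in V : d_{G_1}(v) \le n^{1/3}\}$, and let $B$ be the set of vertices $v \in A$ for which there exist $a_1,\dots,a_{s-2} \in V \setminus A$ such that $v,a_1,\dots,a_{s-2}$ induce a copy of $K_{s-1}$ in $G$. Then $|B| = n - o(n)$ as $n \to \infty$.
   Context: A graph $G$ is strongly $K_s$-saturated if adding any edge to $G$ creates a new copy of $K_s$ ($G$ need not be $K_s$-free). $\mathrm{ssat}(n,K_r,K_s)$ is the minimum number of copies of $K_r$ in an $n$-vertex strongly $K_s$-saturated graph. $d_H(v)$ denotes the degree of $v$ in the graph $H$. -}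

module Defs where

open import Data.Nat using (ℕ; zero; suc; _*_; _^_; _≡ᵇ_; _≤ᵇ_)
open import Data.Bool using (Bool; true; false; _∧_; _∨_; not; T)
open import Data.Fin using (Fin; _≟_)
open import Data.Fin.Subset using (Subset; ∣_∣; inside; outside)
open import Data.Vec using (Vec; []; _∷_; lookup)
open import Data.List using (List; []; _∷_; map; _++_; allFin; length; filterᵇ)
open import Data.Bool.ListAction using (all; any)
open import Data.Product using (Σ; _×_)
open import Relation.Binary.PropositionalEquality using (_≡_; _≢_)
open import Relation.Nullary.Decidable using (⌊_⌋)
open import Data.Nat using (_≤_)

record Graph (n : ℕ) : Set where
  field
    adj    : Fin n → Fin n → Bool
    sym    : ∀ i j → adj i j ≡ adj j i
    irrefl : ∀ i → adj i i ≡ false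
open Graph public

_==_ : ∀ {n} → Fin n → Fin n → Bool
i == j = ⌊ i ≟ j ⌋

allSubsets : ∀ n → List (Subset n)
allSubsets zero = [] ∷ []
allSubsets (suc n) = map (inside ∷_) (allSubsets n) ++ map (outside ∷_) (allSubsets n)

isClique : ∀ {n} → (Fin n → Fin n → Bool) → Subset n → Bool
isClique {n} a S =
  all (λ i → all (λ j → not (lookup S i ∧ lookup S j) ∨ (i == j) ∨ a i j) (allFin n)) (allFin n)

isKCopy : ∀ {n} → ℕ → (Fin n → Fin n → Bool) → Subset n → Bool
isKCopy k a S = (∣ S ∣ ≡ᵇ k) ∧ isClique a S

addEdge : ∀ {n} → Graph n → Fin n → Fin n → Fin n → Fin n → Bool
addEdge G u v i j = adj G i j ∨ ((i == u) ∧ (j == v)) ∨ ((i == v) ∧ (j == u))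

countK : ∀ {n} → ℕ → Graph n → ℕ
countK {n} r G = length (filterᵇ (isKCopy r (adj G)) (allSubsets n))

-- Strongly K_s-saturated: adding any non-edge uv creates a new copy of K_s,
-- i.e. a copy of K_s in G + uv containing u and v.
StronglySat : ∀ {n} → ℕ → Graph n → Set
StronglySat {n} s G =
  (u v : Fin n) → u ≢ v → adj G u v ≡ false →
  Σ (Subset n) λ S → T (isKCopy s (addEdge G u v) S) × lookup S u ≡ true × lookup S v ≡ true

SsatExtremal : ∀ {n} → ℕ → ℕ → Graph n → Set
SsatExtremal {n} r s G = StronglySat s G × ((H : Graph n) → StronglySat s H → countK r G ≤ countK r H)

inE1 : ∀ {n} → ℕ → Graph n → Fin n → Fin n → Bool
inE1 {n} r G u v =
  adj G u v ∧ any (λ S → isKCopy r (adj G) S ∧ lookup S u ∧ lookup S v) (allSubsets n)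

degG1 : ∀ {n} → ℕ → Graph n → Fin n → ℕ
degG1 {n} r G v = length (filterᵇ (inE1 r G v) (allFin n))

-- v ∈ A  iff  d_{G_1}(v) ≤ n^{1/3}  iff  d_{G_1}(v)^3 ≤ n.
inA : ∀ {n} → ℕ → Graph n → Fin n → Bool
inA {n} r G v = (degG1 r G v ^ 3) ≤ᵇ n

inB : ∀ {n} → ℕ → ℕ → Graph n → Fin n → Bool
inB {n} r s G v =
  inA r G v ∧
  any (λ S → isKCopy (s Data.Nat.∸ 1) (adj G) S ∧ lookup S v ∧
             all (λ w → not (lookup S w) ∨ (w == v) ∨ not (inA r G w)) (allFin n))
      (allSubsets n)

sizeB : ∀ {n} → ℕ → ℕ → Graph n → ℕ
sizeB {n} r s G = length (filterᵇ (inB r s G) (allFin n))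

-- The complete split graph (a clique on t = s − 2 vertices joined to an independent set) is strongly
-- K_s-saturated and has at most (n + 1)·2^(t+1) copies of K_r, so an extremal G has O(n) copies of K_r.
-- Every edge of G₁ lies in one of them, hence the G₁-degrees sum to O(n) and only o(n) vertices have
-- G₁-degree above Q = ⌊n^(1/3)⌋, i.e. lie outside A. For u ∈ A ∖ B and a non-neighbour v, saturation
-- gives an (s − 1)-clique of G through u and not v; since u ∉ B it contains some w ∈ A, and uw, wv lie in
-- copies of K_r. As u and w have G₁-degree at most Q, u has at most Q² non-neighbours. Greedily, every
-- edge inside A ∖ B then extends to a K_r within A ∖ B once |A ∖ B| > r(Q² + 1), so a vertex of A ∖ B
-- has G₁-degree at least |A ∖ B| − Q² − 1; as this is at most Q, |A ∖ B| = O(Q²) = o(n).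

module Submission where

open import Defs hiding (sym)
open import Data.Bool using (Bool; true; false; _∧_; _∨_; not)
open import Data.Bool.ListAction using (all; any)
open import Data.Bool.Properties using (∧-conicalˡ; ∧-conicalʳ; ∧-zeroʳ; ∨-conicalˡ; ∨-conicalʳ; ∨-zeroʳ; ∨-identityʳ; ∨-comm; T-≡)
open import Data.Fin using (Fin; zero; suc; toℕ; _≟_)
open import Data.Fin.Subset using (Subset; ∣_∣; inside; outside)
open import Data.List using (List; []; _∷_; map; _++_; length; filterᵇ; allFin)
open import Data.List.Membership.Propositional using (_∈_)
open import Data.List.Membership.Propositional.Properties using (∈-allFin; ∈-map⁺; ∈-++⁺ˡ; ∈-++⁺ʳ)
open import Data.List.Properties using (map-tabulate; length-tabulate)
open import Data.List.Relation.Unary.Any using (here; there)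
open import Data.Nat using (ℕ; zero; suc; _+_; _*_; _∸_; _^_; _≤_; _<_; z≤n; s≤s; _<ᵇ_; _≤?_; >-nonZero)
open import Data.Nat.Properties hiding (_≟_)
open import Algebra.Properties.CommutativeSemigroup +-commutativeSemigroup using () renaming (interchange to +-interchange)
open import Data.Nat.Tactic.RingSolver using (solve-∀)
open import Data.Product using (Σ; ∃-syntax; _×_; _,_; proj₁; proj₂)
open import Data.Sum using (_⊎_; inj₁; inj₂; swap; [_,_]′; map₂)
open import Data.Unit using (tt)
open import Data.Vec using ([]; _∷_; lookup; tabulate)
open import Data.Vec.Properties using (lookup∘tabulate)
open import Function using (_∘_; Equivalence)
open import Relation.Binary.PropositionalEquality
open import Relation.Nullary using (¬_; yes; no; contradiction)

𝟙 : Bool → ℕ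
𝟙 true = 1
𝟙 false = 0

not-true⇒false : {b : Bool} → not b ≡ true → b ≡ false
not-true⇒false {false} _ = refl

not-false⇒true : {b : Bool} → not b ≡ false → b ≡ true
not-false⇒true {true} _ = refl

private variable
  X Y I : Set

-- countK, degG1 and sizeB of Defs are instances of count by definition.
count : (X → Bool) → List X → ℕ
count P xs = length (filterᵇ P xs)

∑ : (X → ℕ) → List X → ℕ
∑ f [] = 0
∑ f (x ∷ xs) = f x + ∑ f xs

∑-cong : {f g : X → ℕ} (xs : List X) → (∀ x → f x ≡ g x) → ∑ f xs ≡ ∑ g xs
∑-cong [] h = refl
∑-cong (x ∷ xs) h = cong₂ _+_ (h x) (∑-cong xs h)

∑-mono-≤ : {f g : X → ℕ} (xs : List X) → (∀ x → f x ≤ g x) → ∑ f xs ≤ ∑ g xs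
∑-mono-≤ [] h = z≤n
∑-mono-≤ (x ∷ xs) h = +-mono-≤ (h x) (∑-mono-≤ xs h)

∑-zero : (xs : List X) → ∑ (λ _ → 0) xs ≡ 0
∑-zero [] = refl
∑-zero (x ∷ xs) = ∑-zero xs

∑-const : (c : ℕ) (xs : List X) → ∑ (λ _ → c) xs ≡ length xs * c
∑-const c [] = refl
∑-const c (x ∷ xs) = cong (c +_) (∑-const c xs)

∑-distrib-+ : (f g : X → ℕ) (xs : List X) → ∑ (λ x → f x + g x) xs ≡ ∑ f xs + ∑ g xs
∑-distrib-+ f g [] = refl
∑-distrib-+ f g (x ∷ xs) =
  trans (cong (f x + g x +_) (∑-distrib-+ f g xs)) (+-interchange (f x) (g x) (∑ f xs) (∑ g xs))

∑-distribʳ-* : (f : X → ℕ) (c : ℕ) (xs : List X) → ∑ (λ x → f x * c) xs ≡ ∑ f xs * c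
∑-distribʳ-* f c [] = refl
∑-distribʳ-* f c (x ∷ xs) = trans (cong (f x * c +_) (∑-distribʳ-* f c xs)) (sym (*-distribʳ-+ c (f x) (∑ f xs)))

∑-comm : (F : X → I → ℕ) (xs : List X) (cs : List I) →
  ∑ (λ x → ∑ (F x) cs) xs ≡ ∑ (λ c → ∑ (λ x → F x c) xs) cs
∑-comm F [] cs = sym (∑-zero cs)
∑-comm F (x ∷ xs) cs = trans (cong (∑ (F x) cs +_) (∑-comm F xs cs))
                             (sym (∑-distrib-+ (F x) (λ c → ∑ (λ y → F y c) xs) cs))

∈⇒≤∑ : (f : X → ℕ) {x : X} {xs : List X} → x ∈ xs → f x ≤ ∑ f xs
∈⇒≤∑ f {xs = y ∷ xs} (here refl) = m≤m+n (f y) _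
∈⇒≤∑ f {xs = y ∷ xs} (there x∈xs) = ≤-trans (∈⇒≤∑ f x∈xs) (m≤n+m _ (f y))

count-∷ : (P : X → Bool) (x : X) (xs : List X) → count P (x ∷ xs) ≡ 𝟙 (P x) + count P xs
count-∷ P x xs with P x
... | true = refl
... | false = refl

count≡∑𝟙 : (P : X → Bool) (xs : List X) → count P xs ≡ ∑ (𝟙 ∘ P) xs
count≡∑𝟙 P [] = refl
count≡∑𝟙 P (x ∷ xs) = trans (count-∷ P x xs) (cong (𝟙 (P x) +_) (count≡∑𝟙 P xs))

count-cong : {P Q : X → Bool} (xs : List X) → (∀ x → P x ≡ Q x) → count P xs ≡ count Q xs
count-cong {P = P} {Q = Q} xs h = trans (count≡∑𝟙 P xs) (trans (∑-cong xs (cong 𝟙 ∘ h)) (sym (count≡∑𝟙 Q xs)))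

count-false : (xs : List X) → count (λ _ → false) xs ≡ 0
count-false [] = refl
count-false (x ∷ xs) = count-false xs

count-∧ˡ : (b : Bool) (P : X → Bool) (xs : List X) → count (λ x → b ∧ P x) xs ≡ 𝟙 b * count P xs
count-∧ˡ true P xs = sym (+-identityʳ _)
count-∧ˡ false P xs = count-false xs

count-split : (P Q : X → Bool) (xs : List X) →
  count P xs ≡ count (λ x → P x ∧ Q x) xs + count (λ x → P x ∧ not (Q x)) xs
count-split P Q [] = refl
count-split P Q (x ∷ xs) with P x | Q x
... | true | true = cong suc (count-split P Q xs)
... | true | false = trans (cong suc (count-split P Q xs)) (sym (+-suc _ _))
... | false | _ = count-split P Q xs

count+count-not : (P : X → Bool) (xs : List X) → count P xs + count (not ∘ P) xs ≡ length xs
count+count-not P [] = refl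
count+count-not P (x ∷ xs) with P x
... | true = cong suc (count+count-not P xs)
... | false = trans (+-suc _ _) (cong suc (count+count-not P xs))

count-++ : (P : X → Bool) (xs ys : List X) → count P (xs ++ ys) ≡ count P xs + count P ys
count-++ P [] ys = refl
count-++ P (x ∷ xs) ys with P x
... | true = cong suc (count-++ P xs ys)
... | false = count-++ P xs ys

count-map : (P : Y → Bool) (f : X → Y) (xs : List X) → count P (map f xs) ≡ count (P ∘ f) xs
count-map P f [] = refl
count-map P f (x ∷ xs) with P (f x)
... | true = cong suc (count-map P f xs)
... | false = count-map P f xs

count-witness : (P : X → Bool) (xs : List X) → 0 < count P xs → ∃[ x ] P x ≡ true
count-witness P (x ∷ xs) pos with P x in eq
... | true = x , eq
... | false = count-witness P xs pos

count-unionBound : (P R : X → Bool) (Q : I → X → Bool) (cs : List I) (xs : List X) →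
  (∀ x → P x ≡ true → R x ≡ true ⊎ ∃[ c ] c ∈ cs × Q c x ≡ true) →
  count P xs ≤ count R xs + ∑ (λ c → count (Q c) xs) cs
count-unionBound P R Q cs xs cover = begin
  count P xs
    ≡⟨ count≡∑𝟙 P xs ⟩
  ∑ (𝟙 ∘ P) xs
    ≤⟨ ∑-mono-≤ xs pointwise ⟩
  ∑ (λ x → 𝟙 (R x) + ∑ (λ c → 𝟙 (Q c x)) cs) xs
    ≡⟨ ∑-distrib-+ _ _ xs ⟩
  ∑ (𝟙 ∘ R) xs + ∑ (λ x → ∑ (λ c → 𝟙 (Q c x)) cs) xs
    ≡⟨ cong₂ _+_ (sym (count≡∑𝟙 R xs)) (∑-comm (λ x c → 𝟙 (Q c x)) xs cs) ⟩
  count R xs + ∑ (λ c → ∑ (𝟙 ∘ Q c) xs) cs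
    ≡⟨ cong (count R xs +_) (∑-cong cs (λ c → sym (count≡∑𝟙 (Q c) xs))) ⟩
  count R xs + ∑ (λ c → count (Q c) xs) cs ∎
  where
  open ≤-Reasoning
  pointwise : ∀ x → 𝟙 (P x) ≤ 𝟙 (R x) + ∑ (λ c → 𝟙 (Q c x)) cs
  pointwise x with P x in Px
  ... | false = z≤n
  ... | true with cover x Px
  ...   | inj₁ Rx rewrite Rx = s≤s z≤n
  ...   | inj₂ (c , c∈cs , Qcx) =
          ≤-trans (subst (λ b → 1 ≤ 𝟙 b) (sym Qcx) ≤-refl)
                  (≤-trans (∈⇒≤∑ (λ c → 𝟙 (Q c x)) c∈cs) (m≤n+m _ _))

count-≤-+ : (P Q R : X → Bool) (xs : List X) →
  (∀ x → P x ≡ true → Q x ≡ true ⊎ R x ≡ true) → count P xs ≤ count Q xs + count R xs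
count-≤-+ P Q R xs cover =
  subst (λ m → count P xs ≤ count Q xs + m) (+-identityʳ _)
    (count-unionBound P Q (λ _ → R) (tt ∷ []) xs (λ x Px → map₂ (λ Rx → tt , here refl , Rx) (cover x Px)))

𝟙-mono-≤ : {a b : Bool} → (a ≡ true → b ≡ true) → 𝟙 a ≤ 𝟙 b
𝟙-mono-≤ {false} h = z≤n
𝟙-mono-≤ {true} h rewrite h refl = ≤-refl

count-mono-≤ : (P Q : X → Bool) (xs : List X) → (∀ x → P x ≡ true → Q x ≡ true) → count P xs ≤ count Q xs
count-mono-≤ P Q xs h = begin
  count P xs    ≡⟨ count≡∑𝟙 P xs ⟩
  ∑ (𝟙 ∘ P) xs  ≤⟨ ∑-mono-≤ xs (λ x → 𝟙-mono-≤ (h x)) ⟩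
  ∑ (𝟙 ∘ Q) xs  ≡⟨ sym (count≡∑𝟙 Q xs) ⟩
  count Q xs    ∎
  where open ≤-Reasoning

count*≡∑ : (P : X → Bool) (c : ℕ) (xs : List X) → count P xs * c ≡ ∑ (λ x → 𝟙 (P x) * c) xs
count*≡∑ P c xs = trans (cong (_* c) (count≡∑𝟙 P xs)) (sym (∑-distribʳ-* (𝟙 ∘ P) c xs))

count*≤∑ : (P : X → Bool) (f : X → ℕ) (c : ℕ) (xs : List X) →
  (∀ x → P x ≡ true → c ≤ f x) → count P xs * c ≤ ∑ f xs
count*≤∑ P f c xs h = ≤-trans (≤-reflexive (count*≡∑ P c xs)) (∑-mono-≤ xs pointwise)
  where
  pointwise : ∀ x → 𝟙 (P x) * c ≤ f x
  pointwise x with P x in Px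
  ... | true = ≤-trans (≤-reflexive (+-identityʳ c)) (h x Px)
  ... | false = z≤n

∑≤count* : (P : X → Bool) (f : X → ℕ) (c : ℕ) (xs : List X) →
  (∀ x → f x ≤ 𝟙 (P x) * c) → ∑ f xs ≤ count P xs * c
∑≤count* P f c xs h = ≤-trans (∑-mono-≤ xs h) (≤-reflexive (sym (count*≡∑ P c xs)))

all-intro : (f : X → Bool) (xs : List X) → (∀ x → x ∈ xs → f x ≡ true) → all f xs ≡ true
all-intro f [] h = refl
all-intro f (x ∷ xs) h rewrite h x (here refl) = all-intro f xs (λ y y∈xs → h y (there y∈xs))

all-elim : (f : X → Bool) (xs : List X) → all f xs ≡ true → ∀ {x} → x ∈ xs → f x ≡ true
all-elim f (y ∷ xs) h x∈ with f y in fy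
all-elim f (y ∷ xs) h (here refl) | true = fy
all-elim f (y ∷ xs) h (there x∈xs) | true = all-elim f xs h x∈xs

all-false⇒∃ : (f : X → Bool) (xs : List X) → all f xs ≡ false → ∃[ x ] x ∈ xs × f x ≡ false
all-false⇒∃ f (y ∷ xs) h with f y in fy
... | false = y , here refl , fy
... | true with all-false⇒∃ f xs h
...   | x , x∈xs , fx = x , there x∈xs , fx

any-intro : (f : X → Bool) (xs : List X) {x : X} → x ∈ xs → f x ≡ true → any f xs ≡ true
any-intro f (y ∷ xs) (here refl) fx rewrite fx = refl
any-intro f (y ∷ xs) (there x∈xs) fx with f y
... | true = refl
... | false = any-intro f xs x∈xs fx

any-elim : (f : X → Bool) (xs : List X) → any f xs ≡ true → ∃[ x ] f x ≡ true
any-elim f (y ∷ xs) h with f y in fy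
... | true = y , fy
... | false = any-elim f xs h

any-false⇒ : (f : X → Bool) (xs : List X) → any f xs ≡ false → ∀ {x} → x ∈ xs → f x ≡ false
any-false⇒ f xs h {x} x∈xs with f x in fx
... | false = refl
... | true = contradiction (trans (sym (any-intro f xs x∈xs fx)) h) λ ()

module _ {n : ℕ} where

  ==-refl : (i : Fin n) → (i == i) ≡ true
  ==-refl i with i ≟ i
  ... | yes _ = refl
  ... | no i≢i = contradiction refl i≢i

  ==⇒≡ : {i j : Fin n} → (i == j) ≡ true → i ≡ j
  ==⇒≡ {i} {j} h with i ≟ j
  ... | yes i≡j = i≡j

  ≢⇒==-false : {i j : Fin n} → i ≢ j → (i == j) ≡ false
  ≢⇒==-false {i} {j} i≢j with i ≟ j
  ... | yes i≡j = contradiction i≡j i≢j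
  ... | no _ = refl

  ==-false⇒≢ : {i j : Fin n} → (i == j) ≡ false → i ≢ j
  ==-false⇒≢ {i} h refl = contradiction (trans (sym (==-refl i)) h) λ ()

  ==-sym : (i j : Fin n) → (i == j) ≡ (j == i)
  ==-sym i j with i ≟ j
  ... | yes refl = sym (==-refl i)
  ... | no i≢j = sym (≢⇒==-false (i≢j ∘ sym))

==-suc : {n : ℕ} (i j : Fin n) → (suc i == suc j) ≡ (i == j)
==-suc i j with i ≟ j
... | yes _ = refl
... | no _ = refl

length-allFin : (n : ℕ) → length (allFin n) ≡ n
length-allFin n = length-tabulate (λ i → i)

count-allFin-suc : {n : ℕ} (P : Fin (suc n) → Bool) →
  count P (allFin (suc n)) ≡ 𝟙 (P zero) + count (P ∘ suc) (allFin n)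
count-allFin-suc {n} P = begin
  count P (allFin (suc n))                    ≡⟨ cong (count P ∘ (zero ∷_)) (map-tabulate (λ i → i) suc) ⟨
  count P (zero ∷ map suc (allFin n))         ≡⟨ count-∷ P zero _ ⟩
  𝟙 (P zero) + count P (map suc (allFin n))   ≡⟨ cong (𝟙 (P zero) +_) (count-map P suc (allFin n)) ⟩
  𝟙 (P zero) + count (P ∘ suc) (allFin n)     ∎
  where open ≡-Reasoning

count-== : {n : ℕ} (c : Fin n) → count (_== c) (allFin n) ≡ 1
count-== {suc n} zero = trans (count-allFin-suc {n} (_== zero)) (cong suc (count-false (allFin n)))
count-== {suc n} (suc c) = trans (count-allFin-suc {n} (_== suc c))
  (trans (count-cong (allFin n) (λ i → ==-suc i c)) (count-== c))

count-pick : {n : ℕ} (P : Fin n → Bool) (c : Fin n) →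
  count P (allFin n) ≡ count (λ i → P i ∧ not (i == c)) (allFin n) + 𝟙 (P c)
count-pick {n} P c = begin
  count P (allFin n)                                   ≡⟨ count-split P (_== c) (allFin n) ⟩
  count (λ i → P i ∧ (i == c)) (allFin n) + rest       ≡⟨ +-comm _ rest ⟩
  rest + count (λ i → P i ∧ (i == c)) (allFin n)       ≡⟨ cong (rest +_) (count-cong (allFin n) at-c) ⟩
  rest + count (λ i → P c ∧ (i == c)) (allFin n)       ≡⟨ cong (rest +_) (count-∧ˡ (P c) (_== c) (allFin n)) ⟩
  rest + 𝟙 (P c) * count (_== c) (allFin n)            ≡⟨ cong (λ m → rest + 𝟙 (P c) * m) (count-== c) ⟩
  rest + 𝟙 (P c) * 1                                   ≡⟨ cong (rest +_) (*-identityʳ (𝟙 (P c))) ⟩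
  rest + 𝟙 (P c)                                       ∎
  where
  open ≡-Reasoning
  rest = count (λ i → P i ∧ not (i == c)) (allFin n)
  at-c : ∀ i → (P i ∧ (i == c)) ≡ (P c ∧ (i == c))
  at-c i with i ≟ c
  ... | yes refl = refl
  ... | no _ = trans (∧-zeroʳ (P i)) (sym (∧-zeroʳ (P c)))

size : {n : ℕ} → Subset n → ℕ
size {n} S = count (lookup S) (allFin n)

size≡∣∣ : {n : ℕ} (S : Subset n) → size S ≡ ∣ S ∣
size≡∣∣ [] = refl
size≡∣∣ (true ∷ S) = trans (count-allFin-suc (lookup (true ∷ S))) (cong suc (size≡∣∣ S))
size≡∣∣ (false ∷ S) = trans (count-allFin-suc (lookup (false ∷ S))) (size≡∣∣ S)

∈-allSubsets : {n : ℕ} (S : Subset n) → S ∈ allSubsets n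
∈-allSubsets [] = here refl
∈-allSubsets {suc n} (true ∷ S) = ∈-++⁺ˡ (∈-map⁺ (inside ∷_) (∈-allSubsets S))
∈-allSubsets {suc n} (false ∷ S) = ∈-++⁺ʳ (map (inside ∷_) (allSubsets n)) (∈-map⁺ (outside ∷_) (∈-allSubsets S))

count-allSubsets-suc : {n : ℕ} (P : Subset (suc n) → Bool) →
  count P (allSubsets (suc n)) ≡ count (P ∘ (inside ∷_)) (allSubsets n) + count (P ∘ (outside ∷_)) (allSubsets n)
count-allSubsets-suc {n} P = trans (count-++ P (map (inside ∷_) (allSubsets n)) _)
  (cong₂ _+_ (count-map P (inside ∷_) (allSubsets n)) (count-map P (outside ∷_) (allSubsets n)))

_⊆_ : {n : ℕ} → Subset n → (Fin n → Bool) → Set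
S ⊆ P = ∀ i → lookup S i ≡ true → P i ≡ true

_⊆ᵇ_ : {n : ℕ} → Subset n → Subset n → Bool
[] ⊆ᵇ [] = true
(x ∷ S) ⊆ᵇ (y ∷ T) = (not x ∨ y) ∧ (S ⊆ᵇ T)

⊆⇒⊆ᵇ : {n : ℕ} (S T : Subset n) → S ⊆ lookup T → (S ⊆ᵇ T) ≡ true
⊆⇒⊆ᵇ [] [] h = refl
⊆⇒⊆ᵇ (false ∷ S) (y ∷ T) h = ⊆⇒⊆ᵇ S T (h ∘ suc)
⊆⇒⊆ᵇ (true ∷ S) (y ∷ T) h rewrite h zero refl = ⊆⇒⊆ᵇ S T (h ∘ suc)

count-⊆ᵇ : {n : ℕ} (T : Subset n) → count (_⊆ᵇ T) (allSubsets n) ≡ 2 ^ size T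
count-⊆ᵇ [] = refl
count-⊆ᵇ {suc n} (y ∷ T) = begin
  count (_⊆ᵇ (y ∷ T)) (allSubsets (suc n))
    ≡⟨ count-allSubsets-suc (_⊆ᵇ (y ∷ T)) ⟩
  count (λ S → y ∧ (S ⊆ᵇ T)) (allSubsets n) + count (_⊆ᵇ T) (allSubsets n)
    ≡⟨ cong (_+ count (_⊆ᵇ T) (allSubsets n)) (count-∧ˡ y (_⊆ᵇ T) (allSubsets n)) ⟩
  𝟙 y * count (_⊆ᵇ T) (allSubsets n) + count (_⊆ᵇ T) (allSubsets n)
    ≡⟨ cong (λ m → 𝟙 y * m + m) (count-⊆ᵇ T) ⟩
  𝟙 y * 2 ^ size T + 2 ^ size T
    ≡⟨ doubling y (size T) ⟩
  2 ^ (𝟙 y + size T)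
    ≡⟨ cong (2 ^_) (count-allFin-suc (lookup (y ∷ T))) ⟨
  2 ^ size (y ∷ T) ∎
  where
  open ≡-Reasoning
  doubling : (b : Bool) (k : ℕ) → 𝟙 b * 2 ^ k + 2 ^ k ≡ 2 ^ (𝟙 b + k)
  doubling true k = trans (cong (_+ 2 ^ k) (+-identityʳ (2 ^ k))) (cong (2 ^ k +_) (sym (+-identityʳ (2 ^ k))))
  doubling false k = refl

module _ {n : ℕ} where

  remove : Subset n → Fin n → Subset n
  remove S x = tabulate (λ i → lookup S i ∧ not (i == x))

  insert : Subset n → Fin n → Subset n
  insert S x = tabulate (λ i → lookup S i ∨ (i == x))

  ∅ : Subset n
  ∅ = tabulate (λ _ → false)

  lookup-remove : (S : Subset n) (x i : Fin n) → lookup (remove S x) i ≡ (lookup S i ∧ not (i == x))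
  lookup-remove S x = lookup∘tabulate _

  lookup-insert : (S : Subset n) (x i : Fin n) → lookup (insert S x) i ≡ (lookup S i ∨ (i == x))
  lookup-insert S x = lookup∘tabulate _

  remove⁺ : (S : Subset n) {x i : Fin n} → lookup S i ≡ true → i ≢ x → lookup (remove S x) i ≡ true
  remove⁺ S {x} {i} i∈S i≢x = trans (lookup-remove S x i) (cong₂ _∧_ i∈S (cong not (≢⇒==-false i≢x)))

  remove⊆ : (S : Subset n) (x : Fin n) → remove S x ⊆ lookup S
  remove⊆ S x i h = ∧-conicalˡ _ _ (trans (sym (lookup-remove S x i)) h)

  remove-≢ : (S : Subset n) (x : Fin n) {i : Fin n} → lookup (remove S x) i ≡ true → i ≢ x
  remove-≢ S x {i} h = ==-false⇒≢ (not-true⇒false (∧-conicalʳ _ _ (trans (sym (lookup-remove S x i)) h)))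

  insert-new : (S : Subset n) (x : Fin n) → lookup (insert S x) x ≡ true
  insert-new S x = trans (lookup-insert S x x) (trans (cong (lookup S x ∨_) (==-refl x)) (∨-zeroʳ _))

  insert-old : (S : Subset n) (x : Fin n) → S ⊆ lookup (insert S x)
  insert-old S x i h = trans (lookup-insert S x i) (cong (_∨ (i == x)) h)

  insert⁻ : (S : Subset n) (x i : Fin n) → lookup (insert S x) i ≡ true → lookup S i ≡ true ⊎ i ≡ x
  insert⁻ S x i h with lookup S i | i == x in i=x | trans (sym (lookup-insert S x i)) h
  ... | true | _ | _ = inj₁ refl
  ... | false | true | _ = inj₂ (==⇒≡ i=x)

  size-remove : (S : Subset n) (x : Fin n) → lookup S x ≡ true → size S ≡ suc (size (remove S x))
  size-remove S x x∈S = begin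
    size S                                                   ≡⟨ count-pick (lookup S) x ⟩
    count (λ i → lookup S i ∧ not (i == x)) (allFin n) + 𝟙 (lookup S x)
                                                             ≡⟨ cong₂ _+_ (count-cong (allFin n) (sym ∘ lookup-remove S x)) (cong 𝟙 x∈S) ⟩
    size (remove S x) + 1                                    ≡⟨ +-comm _ 1 ⟩
    suc (size (remove S x))                                  ∎
    where open ≡-Reasoning

  size-insert : (S : Subset n) (x : Fin n) → lookup S x ≡ false → size (insert S x) ≡ suc (size S)
  size-insert S x x∉S = begin
    size (insert S x)                                               ≡⟨ count-pick (lookup (insert S x)) x ⟩
    count (λ i → lookup (insert S x) i ∧ not (i == x)) (allFin n) + 𝟙 (lookup (insert S x) x)
                                                                    ≡⟨ cong₂ _+_ (count-cong (allFin n) away-from-x) (cong 𝟙 (insert-new S x)) ⟩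
    size-without-x + 1                                              ≡⟨ cong (_+ 1) size-without-x≡size ⟩
    size S + 1                                                      ≡⟨ +-comm _ 1 ⟩
    suc (size S)                                                    ∎
    where
    open ≡-Reasoning
    size-without-x = count (λ i → lookup S i ∧ not (i == x)) (allFin n)
    size-without-x≡size : size-without-x ≡ size S
    size-without-x≡size = sym (trans (count-pick (lookup S) x) (trans (cong (λ b → size-without-x + 𝟙 b) x∉S) (+-identityʳ _)))
    away-from-x : ∀ i → (lookup (insert S x) i ∧ not (i == x)) ≡ (lookup S i ∧ not (i == x))
    away-from-x i rewrite lookup-insert S x i with i == x
    ... | true = trans (∧-zeroʳ _) (sym (∧-zeroʳ _))
    ... | false = cong (_∧ true) (∨-identityʳ _)

  size-insert-≤ : (S : Subset n) (x : Fin n) → size (insert S x) ≤ suc (size S)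
  size-insert-≤ S x = begin
    size (insert S x)                        ≤⟨ count-≤-+ _ (lookup S) (_== x) (allFin n) split ⟩
    size S + count (_== x) (allFin n)        ≡⟨ cong (size S +_) (count-== x) ⟩
    size S + 1                               ≡⟨ +-comm _ 1 ⟩
    suc (size S)                             ∎
    where
    open ≤-Reasoning
    split : ∀ i → lookup (insert S x) i ≡ true → lookup S i ≡ true ⊎ (i == x) ≡ true
    split i h with insert⁻ S x i h
    ... | inj₁ i∈S = inj₁ i∈S
    ... | inj₂ refl = inj₂ (==-refl i)

  size-∅ : size ∅ ≡ 0
  size-∅ = trans (count-cong (allFin n) (lookup∘tabulate _)) (count-false (allFin n))

  pair : Fin n → Fin n → Subset n
  pair x y = insert (insert ∅ x) y

  pair⁻ : (x y i : Fin n) → lookup (pair x y) i ≡ true → i ≡ x ⊎ i ≡ y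
  pair⁻ x y i h with insert⁻ (insert ∅ x) y i h
  ... | inj₂ i≡y = inj₂ i≡y
  ... | inj₁ h′ with insert⁻ ∅ x i h′
  ...   | inj₂ i≡x = inj₁ i≡x
  ...   | inj₁ i∈∅ = contradiction (trans (sym (lookup∘tabulate _ i)) i∈∅) λ ()

  size-pair : {x y : Fin n} → x ≢ y → size (pair x y) ≡ 2
  size-pair {x} {y} x≢y = begin
    size (pair x y)          ≡⟨ size-insert (insert ∅ x) y y∉ ⟩
    suc (size (insert ∅ x))  ≡⟨ cong suc (size-insert ∅ x (lookup∘tabulate _ x)) ⟩
    suc (suc (size ∅))       ≡⟨ cong (λ m → suc (suc m)) size-∅ ⟩
    2                        ∎
    where
    open ≡-Reasoning
    y∉ : lookup (insert ∅ x) y ≡ false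
    y∉ = trans (lookup-insert ∅ x y) (cong₂ _∨_ (lookup∘tabulate _ y) (≢⇒==-false (x≢y ∘ sym)))

  pair-fst : (x y : Fin n) → lookup (pair x y) x ≡ true
  pair-fst x y = insert-old (insert ∅ x) y x (insert-new ∅ x)

  pair-snd : (x y : Fin n) → lookup (pair x y) y ≡ true
  pair-snd x y = insert-new (insert ∅ x) y

  third-element : (S : Subset n) {x y : Fin n} → lookup S x ≡ true → lookup S y ≡ true → x ≢ y →
    2 < size S → ∃[ c ] lookup S c ≡ true × c ≢ x × c ≢ y
  third-element S {x} {y} x∈S y∈S x≢y 2<|S| = c , c∈S , c≢x , c≢y
    where
    S-x-y : Subset n
    S-x-y = remove (remove S x) y
    |S|≡ : size S ≡ suc (suc (size S-x-y))
    |S|≡ = trans (size-remove S x x∈S) (cong suc (size-remove (remove S x) y (remove⁺ S y∈S (x≢y ∘ sym))))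
    third : ∃[ c ] lookup S-x-y c ≡ true
    third = count-witness (lookup S-x-y) (allFin n) (≤-pred (≤-pred (subst (2 <_) |S|≡ 2<|S|)))
    c : Fin n
    c = proj₁ third
    c∈S-x : lookup (remove S x) c ≡ true
    c∈S-x = remove⊆ (remove S x) y c (proj₂ third)
    c∈S : lookup S c ≡ true
    c∈S = remove⊆ S x c c∈S-x
    c≢y : c ≢ y
    c≢y = remove-≢ (remove S x) y (proj₂ third)
    c≢x : c ≢ x
    c≢x = remove-≢ S x c∈S-x

  shrink : {r : ℕ} → 2 ≤ r → (d : ℕ) (S : Subset n) → size S ≡ r + d →
    {x y : Fin n} → lookup S x ≡ true → lookup S y ≡ true → x ≢ y →
    ∃[ T ] T ⊆ lookup S × size T ≡ r × lookup T x ≡ true × lookup T y ≡ true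
  shrink {r} _ zero S |S|≡r x∈S y∈S _ = S , (λ _ i∈S → i∈S) , trans |S|≡r (+-identityʳ r) , x∈S , y∈S
  shrink {r} 2≤r (suc d) S |S|≡r+d {x} {y} x∈S y∈S x≢y = T , T⊆S , rest
    where
    2<|S| : 2 < size S
    2<|S| = subst (2 <_) (sym |S|≡r+d) (+-mono-≤-< {2} {r} {0} {suc d} 2≤r (s≤s z≤n))
    third = third-element S x∈S y∈S x≢y 2<|S|
    c : Fin n
    c = proj₁ third
    c∈S : lookup S c ≡ true
    c∈S = proj₁ (proj₂ third)
    |S-c|≡r+d : size (remove S c) ≡ r + d
    |S-c|≡r+d = suc-injective (trans (sym (size-remove S c c∈S)) (trans |S|≡r+d (+-suc r d)))
    smaller = shrink 2≤r d (remove S c) |S-c|≡r+d (remove⁺ S x∈S (proj₁ (proj₂ (proj₂ third)) ∘ sym))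
                (remove⁺ S y∈S (proj₂ (proj₂ (proj₂ third)) ∘ sym)) x≢y
    T : Subset n
    T = proj₁ smaller
    T⊆S : T ⊆ lookup S
    T⊆S i i∈T = remove⊆ S c i (proj₁ (proj₂ smaller) i i∈T)
    rest : size T ≡ r × lookup T x ≡ true × lookup T y ≡ true
    rest = proj₂ (proj₂ smaller)

module _ {n : ℕ} (a : Fin n → Fin n → Bool) where

  IsClique : Subset n → Set
  IsClique S = ∀ {i j} → lookup S i ≡ true → lookup S j ≡ true → i ≢ j → a i j ≡ true

  isClique⁺ : (S : Subset n) → IsClique S → isClique a S ≡ true
  isClique⁺ S clique = all-intro _ (allFin n) λ i _ → all-intro _ (allFin n) λ j _ → pairwise i j
    where
    pairwise : ∀ i j → (not (lookup S i ∧ lookup S j) ∨ (i == j) ∨ a i j) ≡ true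
    pairwise i j with lookup S i in i∈S | lookup S j in j∈S | i ≟ j
    ... | false | _ | _ = refl
    ... | true | false | _ = refl
    ... | true | true | yes _ = refl
    ... | true | true | no i≢j = clique i∈S j∈S i≢j

  isClique⁻ : (S : Subset n) → isClique a S ≡ true → IsClique S
  isClique⁻ S h {i} {j} i∈S j∈S i≢j =
    subst (λ b → (b ∨ a i j) ≡ true) (≢⇒==-false i≢j)
      (subst (λ b → (not b ∨ (i == j) ∨ a i j) ≡ true) (cong₂ _∧_ i∈S j∈S)
        (all-elim _ (allFin n) (all-elim _ (allFin n) h (∈-allFin i)) (∈-allFin j)))

  isKCopy⁺ : {k : ℕ} (S : Subset n) → size S ≡ k → IsClique S → isKCopy k a S ≡ true
  isKCopy⁺ {k} S |S|≡k clique =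
    cong₂ _∧_ (Equivalence.to T-≡ (≡⇒≡ᵇ ∣ S ∣ k (trans (sym (size≡∣∣ S)) |S|≡k))) (isClique⁺ S clique)

  isKCopy⁻ : {k : ℕ} (S : Subset n) → isKCopy k a S ≡ true → size S ≡ k × IsClique S
  isKCopy⁻ {k} S h =
    trans (size≡∣∣ S) (≡ᵇ⇒≡ ∣ S ∣ k (Equivalence.from T-≡ (∧-conicalˡ _ _ h))) ,
    isClique⁻ S (∧-conicalʳ _ _ h)

  IsClique-⊆ : (S T : Subset n) → IsClique S → T ⊆ lookup S → IsClique T
  IsClique-⊆ S T clique T⊆S i∈T j∈T = clique (T⊆S _ i∈T) (T⊆S _ j∈T)

  IsClique-insert : (∀ i j → a i j ≡ a j i) → (S : Subset n) (x : Fin n) → IsClique S →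
    (∀ c → lookup S c ≡ true → a c x ≡ true) → IsClique (insert S x)
  IsClique-insert symmetric S x clique adj-x {i} {j} i∈ j∈ i≢j
    with insert⁻ S x i i∈ | insert⁻ S x j j∈
  ... | inj₁ i∈S | inj₁ j∈S = clique i∈S j∈S i≢j
  ... | inj₁ i∈S | inj₂ refl = adj-x i i∈S
  ... | inj₂ refl | inj₁ j∈S = trans (symmetric i j) (adj-x j j∈S)
  ... | inj₂ refl | inj₂ refl = contradiction refl i≢j

  IsClique-pair : (∀ i j → a i j ≡ a j i) → {u v : Fin n} → a u v ≡ true → IsClique (pair u v)
  IsClique-pair symmetric {u} {v} uv∈E {i} {j} i∈ j∈ i≢j with pair⁻ u v i i∈ | pair⁻ u v j j∈
  ... | inj₁ refl | inj₂ refl = uv∈E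
  ... | inj₂ refl | inj₁ refl = trans (symmetric i j) uv∈E
  ... | inj₁ refl | inj₁ refl = contradiction refl i≢j
  ... | inj₂ refl | inj₂ refl = contradiction refl i≢j

module _ (r : ℕ) {n : ℕ} (G : Graph n) where

  inE1⁺ : (S : Subset n) → IsClique (adj G) S → size S ≡ r →
    {x y : Fin n} → lookup S x ≡ true → lookup S y ≡ true → x ≢ y → inE1 r G x y ≡ true
  inE1⁺ S clique |S|≡r x∈S y∈S x≢y =
    cong₂ _∧_ (clique x∈S y∈S x≢y)
      (any-intro _ (allSubsets n) (∈-allSubsets S)
        (cong₂ _∧_ (isKCopy⁺ (adj G) S |S|≡r clique) (cong₂ _∧_ x∈S y∈S)))

  clique-edge-inE1 : 2 ≤ r → (S : Subset n) → IsClique (adj G) S → r ≤ size S →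
    {x y : Fin n} → lookup S x ≡ true → lookup S y ≡ true → x ≢ y → inE1 r G x y ≡ true
  clique-edge-inE1 2≤r S clique r≤|S| x∈S y∈S x≢y
    with shrink 2≤r (size S ∸ r) S (sym (m+[n∸m]≡n r≤|S|)) x∈S y∈S x≢y
  ... | T , T⊆S , |T|≡r , x∈T , y∈T = inE1⁺ T (IsClique-⊆ (adj G) S T clique T⊆S) |T|≡r x∈T y∈T x≢y

  ∑-degG1 : ∑ (degG1 r G) (allFin n) ≤ countK r G * (r * r)
  ∑-degG1 = begin
    ∑ (degG1 r G) (allFin n)
      ≤⟨ ∑-mono-≤ (allFin n) degree-via-copies ⟩
    ∑ (λ v → ∑ (pairsIn v) (allSubsets n)) (allFin n)
      ≡⟨ ∑-comm pairsIn (allFin n) (allSubsets n) ⟩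
    ∑ (λ S → ∑ (λ v → pairsIn v S) (allFin n)) (allSubsets n)
      ≤⟨ ∑≤count* (isKCopy r (adj G)) _ (r * r) (allSubsets n) pairs-of-copy ⟩
    countK r G * (r * r) ∎
    where
    open ≤-Reasoning
    pairsIn : Fin n → Subset n → ℕ
    pairsIn v S = count (λ u → isKCopy r (adj G) S ∧ lookup S v ∧ lookup S u) (allFin n)
    degree-via-copies : ∀ v → degG1 r G v ≤ ∑ (pairsIn v) (allSubsets n)
    degree-via-copies v = ≤-trans
      (count-unionBound (inE1 r G v) (λ _ → false) (λ S u → isKCopy r (adj G) S ∧ lookup S v ∧ lookup S u)
        (allSubsets n) (allFin n)
        (λ u vu∈E1 → let S , copy = any-elim _ (allSubsets n) (∧-conicalʳ _ _ vu∈E1) in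
                     inj₂ (S , ∈-allSubsets S , copy)))
      (≤-reflexive (cong (_+ ∑ (pairsIn v) (allSubsets n)) (count-false (allFin n))))
    pairs-of-copy : ∀ S → ∑ (λ v → pairsIn v S) (allFin n) ≤ 𝟙 (isKCopy r (adj G) S) * (r * r)
    pairs-of-copy S with isKCopy r (adj G) S in copy
    ... | false = ≤-reflexive (trans (∑-cong (allFin n) (λ _ → count-false (allFin n))) (∑-zero (allFin n)))
    ... | true = ≤-reflexive (begin-equality
      ∑ (λ v → count (λ u → lookup S v ∧ lookup S u) (allFin n)) (allFin n)
        ≡⟨ ∑-cong (allFin n) (λ v → count-∧ˡ (lookup S v) (lookup S) (allFin n)) ⟩
      ∑ (λ v → 𝟙 (lookup S v) * size S) (allFin n)  ≡⟨ count*≡∑ (lookup S) (size S) (allFin n) ⟨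
      size S * size S                                ≡⟨ cong₂ _*_ |S|≡r |S|≡r ⟩
      r * r                                          ≡⟨ +-identityʳ (r * r) ⟨
      1 * (r * r)                                    ∎)
      where |S|≡r = proj₁ (isKCopy⁻ (adj G) S copy)

  notInA⇒deg> : {q : ℕ} → q ^ 3 ≤ n → (v : Fin n) → inA r G v ≡ false → q < degG1 r G v
  notInA⇒deg> q³≤n v v∉A = ≰⇒> λ deg≤q →
    contradiction (trans (sym (Equivalence.to T-≡ (≤⇒≤ᵇ (≤-trans (^-monoˡ-≤ 3 deg≤q) q³≤n)))) v∉A) λ ()

  inA⇒deg≤ : {Q : ℕ} → n < suc Q ^ 3 → (v : Fin n) → inA r G v ≡ true → degG1 r G v ≤ Q
  inA⇒deg≤ n<[Q+1]³ v v∈A = ≮⇒≥ λ Q<deg →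
    <⇒≱ n<[Q+1]³ (≤-trans (^-monoˡ-≤ 3 Q<deg) (≤ᵇ⇒≤ _ n (Equivalence.from T-≡ v∈A)))

  count-notA-≤ : {q : ℕ} → q ^ 3 ≤ n → count (not ∘ inA r G) (allFin n) * suc q ≤ countK r G * (r * r)
  count-notA-≤ {q} q³≤n = ≤-trans
    (count*≤∑ (not ∘ inA r G) (degG1 r G) (suc q) (allFin n)
      (λ v v∉A → notInA⇒deg> q³≤n v (not-true⇒false v∉A)))
    ∑-degG1

module _ {n : ℕ} (G : Graph n) where

  addEdge-uv : (u v : Fin n) → addEdge G u v u v ≡ true
  addEdge-uv u v rewrite ==-refl u | ==-refl v = ∨-zeroʳ (adj G u v)

  addEdge-vu : (u v : Fin n) → addEdge G u v v u ≡ true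
  addEdge-vu u v rewrite ==-refl u | ==-refl v =
    trans (cong (adj G v u ∨_) (∨-zeroʳ ((v == u) ∧ (u == v)))) (∨-zeroʳ (adj G v u))

  addEdge⇒adj : {u v i j : Fin n} → addEdge G u v i j ≡ true →
    ¬ (i ≡ u × j ≡ v) → ¬ (i ≡ v × j ≡ u) → adj G i j ≡ true
  addEdge⇒adj {u} {v} {i} {j} h not-uv not-vu
    with adj G i j | i == u in i=u | j == v in j=v | i == v in i=v | j == u in j=u
  ... | true | _ | _ | _ | _ = refl
  ... | false | true | true | _ | _ = contradiction (==⇒≡ i=u , ==⇒≡ j=v) not-uv
  ... | false | _ | _ | true | true = contradiction (==⇒≡ i=v , ==⇒≡ j=u) not-vu
  ... | false | false | _ | false | _ = h
  ... | false | false | _ | true | false = h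
  ... | false | true | false | false | _ = h
  ... | false | true | false | true | false = h

  IsClique-addEdge-remove : {u v w : Fin n} (S : Subset n) → IsClique (addEdge G u v) S →
    w ≡ u ⊎ w ≡ v → IsClique (adj G) (remove S w)
  IsClique-addEdge-remove {u} {v} {w} S clique w∈uv {i} {j} i∈S-w j∈S-w i≢j =
    addEdge⇒adj (clique (remove⊆ S w i i∈S-w) (remove⊆ S w j j∈S-w) i≢j) (avoid w∈uv) (avoid (swap w∈uv))
    where
    i≢w : i ≢ w
    i≢w = remove-≢ S w i∈S-w
    j≢w : j ≢ w
    j≢w = remove-≢ S w j∈S-w
    avoid : {p q : Fin n} → w ≡ p ⊎ w ≡ q → ¬ (i ≡ p × j ≡ q)
    avoid (inj₁ refl) (i≡w , _) = i≢w i≡w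
    avoid (inj₂ refl) (_ , j≡w) = j≢w j≡w

-- The complete split graph

module CompleteSplit (t : ℕ) {n : ℕ} (t≤n : t ≤ n) where

  core : Fin n → Bool
  core i = toℕ i <ᵇ t

  splitAdj : Fin n → Fin n → Bool
  splitAdj i j = not (i == j) ∧ (core i ∨ core j)

  completeSplit : Graph n
  completeSplit = record
    { adj = splitAdj
    ; sym = λ i j → cong₂ _∧_ (cong not (==-sym i j)) (∨-comm (core i) (core j))
    ; irrefl = λ i → cong (λ b → not b ∧ (core i ∨ core i)) (==-refl i)
    }

  coreSet : Subset n
  coreSet = tabulate core

  size-coreSet : size coreSet ≡ t
  size-coreSet = trans (count-cong (allFin n) (lookup∘tabulate core)) (initial-segment n t t≤n)
    where
    initial-segment : ∀ m k → k ≤ m → count (λ (i : Fin m) → toℕ i <ᵇ k) (allFin m) ≡ k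
    initial-segment m zero _ = count-false (allFin m)
    initial-segment (suc m) (suc k) (s≤s k≤m) =
      trans (count-allFin-suc (λ (i : Fin (suc m)) → toℕ i <ᵇ suc k)) (cong suc (initial-segment m k k≤m))

  splitAdj-core : {i j : Fin n} → i ≢ j → core i ≡ true ⊎ core j ≡ true → splitAdj i j ≡ true
  splitAdj-core {i} {j} i≢j core-i-or-j rewrite ≢⇒==-false i≢j with core-i-or-j
  ... | inj₁ ci = cong (_∨ core j) ci
  ... | inj₂ cj = trans (cong (core i ∨_) cj) (∨-zeroʳ (core i))

  splitAdj-periphery : {i j : Fin n} → core i ≡ false → core j ≡ false → splitAdj i j ≡ false
  splitAdj-periphery {i} ci cj rewrite ci | cj = ∧-zeroʳ (not (i == _))

  completeSplit-stronglySat : StronglySat (t + 2) completeSplit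
  completeSplit-stronglySat u v u≢v uv∉E = S , Equivalence.from T-≡ S-copy , u∈S , v∈S
    where
    periphery : (core u ∨ core v) ≡ false
    periphery = subst (λ b → (not b ∧ (core u ∨ core v)) ≡ false) (≢⇒==-false u≢v) uv∉E
    u∉core : core u ≡ false
    u∉core = ∨-conicalˡ _ _ periphery
    v∉core : core v ≡ false
    v∉core = ∨-conicalʳ _ _ periphery
    S = insert (insert coreSet u) v
    u∈S : lookup S u ≡ true
    u∈S = insert-old (insert coreSet u) v u (insert-new coreSet u)
    v∈S : lookup S v ≡ true
    v∈S = insert-new (insert coreSet u) v
    v∉core+u : lookup (insert coreSet u) v ≡ false
    v∉core+u = trans (lookup-insert coreSet u v)
                     (cong₂ _∨_ (trans (lookup∘tabulate core v) v∉core) (≢⇒==-false (u≢v ∘ sym)))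
    |S| : size S ≡ t + 2
    |S| = begin
      size S                         ≡⟨ size-insert (insert coreSet u) v v∉core+u ⟩
      suc (size (insert coreSet u))  ≡⟨ cong suc (size-insert coreSet u (trans (lookup∘tabulate core u) u∉core)) ⟩
      suc (suc (size coreSet))       ≡⟨ cong (λ m → suc (suc m)) size-coreSet ⟩
      suc (suc t)                    ≡⟨ +-comm 2 t ⟩
      t + 2                          ∎
      where open ≡-Reasoning
    member : ∀ i → lookup S i ≡ true → core i ≡ true ⊎ i ≡ u ⊎ i ≡ v
    member i i∈S with insert⁻ (insert coreSet u) v i i∈S
    ... | inj₂ i≡v = inj₂ (inj₂ i≡v)
    ... | inj₁ i∈core+u with insert⁻ coreSet u i i∈core+u
    ...   | inj₁ i∈core = inj₁ (trans (sym (lookup∘tabulate core i)) i∈core)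
    ...   | inj₂ i≡u = inj₂ (inj₁ i≡u)
    clique : IsClique (addEdge completeSplit u v) S
    clique {i} {j} i∈S j∈S i≢j with member i i∈S | member j j∈S
    ... | inj₁ ci | _ = cong (_∨ _) (splitAdj-core i≢j (inj₁ ci))
    ... | inj₂ _ | inj₁ cj = cong (_∨ _) (splitAdj-core i≢j (inj₂ cj))
    ... | inj₂ (inj₁ refl) | inj₂ (inj₁ refl) = contradiction refl i≢j
    ... | inj₂ (inj₂ refl) | inj₂ (inj₂ refl) = contradiction refl i≢j
    ... | inj₂ (inj₁ refl) | inj₂ (inj₂ refl) = addEdge-uv completeSplit i j
    ... | inj₂ (inj₂ refl) | inj₂ (inj₁ refl) = addEdge-vu completeSplit j i
    S-copy : isKCopy (t + 2) (addEdge completeSplit u v) S ≡ true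
    S-copy = isKCopy⁺ (addEdge completeSplit u v) S |S| clique

  -- two peripheral vertices are never adjacent, so a clique meets the periphery at most once
  clique-⊆-core+1 : (S : Subset n) → IsClique splitAdj S →
    S ⊆ lookup coreSet ⊎ ∃[ x ] S ⊆ lookup (insert coreSet x)
  clique-⊆-core+1 S clique with any (λ i → lookup S i ∧ not (core i)) (allFin n) in peripheral
  ... | false = inj₁ λ i i∈S → trans (lookup∘tabulate core i) (in-core i i∈S)
    where
    in-core : ∀ i → lookup S i ≡ true → core i ≡ true
    in-core i i∈S = not-false⇒true
      (subst (λ b → (b ∧ not (core i)) ≡ false) i∈S (any-false⇒ _ (allFin n) peripheral (∈-allFin i)))
  ... | true with any-elim _ (allFin n) peripheral
  ...   | x , x∈S∖core = inj₂ (x , λ i i∈S → trans (lookup-insert coreSet x i) (core-or-x i i∈S))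
    where
    x∈S : lookup S x ≡ true
    x∈S = ∧-conicalˡ _ _ x∈S∖core
    x∉core : core x ≡ false
    x∉core = not-true⇒false (∧-conicalʳ _ _ x∈S∖core)
    core-or-x : ∀ i → lookup S i ≡ true → (lookup coreSet i ∨ (i == x)) ≡ true
    core-or-x i i∈S with i ≟ x | core i in ci
    ... | yes refl | _ = ∨-zeroʳ _
    ... | no _ | true = cong (_∨ _) (trans (lookup∘tabulate core i) ci)
    ... | no i≢x | false = contradiction (trans (sym (clique i∈S x∈S i≢x)) (splitAdj-periphery ci x∉core)) λ ()

  countK-completeSplit : (r : ℕ) → countK r completeSplit ≤ 2 ^ t + n * 2 ^ suc t
  countK-completeSplit r = begin
    countK r completeSplit
      ≤⟨ count-unionBound (isKCopy r splitAdj) (_⊆ᵇ coreSet) (λ x S → S ⊆ᵇ insert coreSet x)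
                          (allFin n) (allSubsets n) cover ⟩
    count (_⊆ᵇ coreSet) (allSubsets n) + ∑ (λ x → count (_⊆ᵇ insert coreSet x) (allSubsets n)) (allFin n)
      ≡⟨ cong₂ _+_ (count-⊆ᵇ coreSet) (∑-cong (allFin n) (count-⊆ᵇ ∘ insert coreSet)) ⟩
    2 ^ size coreSet + ∑ (λ x → 2 ^ size (insert coreSet x)) (allFin n)
      ≤⟨ +-mono-≤ (≤-reflexive (cong (2 ^_) size-coreSet)) (∑-mono-≤ (allFin n) (λ x → ^-monoʳ-≤ 2 (size-core+1 x))) ⟩
    2 ^ t + ∑ (λ _ → 2 ^ suc t) (allFin n)
      ≡⟨ cong (2 ^ t +_) (trans (∑-const (2 ^ suc t) (allFin n)) (cong (_* 2 ^ suc t) (length-allFin n))) ⟩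
    2 ^ t + n * 2 ^ suc t ∎
    where
    open ≤-Reasoning
    size-core+1 : ∀ x → size (insert coreSet x) ≤ suc t
    size-core+1 x = subst (λ m → size (insert coreSet x) ≤ suc m) size-coreSet (size-insert-≤ coreSet x)
    cover : ∀ S → isKCopy r splitAdj S ≡ true →
      (S ⊆ᵇ coreSet) ≡ true ⊎ ∃[ x ] x ∈ allFin n × (S ⊆ᵇ insert coreSet x) ≡ true
    cover S copy with clique-⊆-core+1 S (proj₂ (isKCopy⁻ splitAdj S copy))
    ... | inj₁ S⊆core = inj₁ (⊆⇒⊆ᵇ S coreSet S⊆core)
    ... | inj₂ (x , S⊆core+x) = inj₂ (x , ∈-allFin x , ⊆⇒⊆ᵇ S (insert coreSet x) S⊆core+x)

-- Greedy growth of cliques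

closedNonNbr : {n : ℕ} → (Fin n → Fin n → Bool) → Fin n → Fin n → Bool
closedNonNbr a u v = (v == u) ∨ not (a u v)

module Greedy {n : ℕ} (a : Fin n → Fin n → Bool) (symmetric : ∀ i j → a i j ≡ a j i)
  (W : Fin n → Bool) (D : ℕ) (sparse : ∀ c → W c ≡ true → count (closedNonNbr a c) (allFin n) ≤ D) where

  adjToAll : Subset n → Fin n → Bool
  adjToAll C x = all (λ c → not (lookup C c) ∨ a c x) (allFin n)

  extend : (C : Subset n) → C ⊆ W → size C * D < count W (allFin n) →
    ∃[ x ] W x ≡ true × lookup C x ≡ false × (∀ c → lookup C c ≡ true → a c x ≡ true)
  extend C C⊆W small = x , W-x , x∉C , adj-x
    where
    candidate : Fin n → Bool
    candidate x = W x ∧ not (lookup C x) ∧ adjToAll C x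
    blocked : Fin n → Fin n → Bool
    blocked c x = lookup C c ∧ closedNonNbr a c x
    cover : ∀ x → W x ≡ true → candidate x ≡ true ⊎ ∃[ c ] c ∈ allFin n × blocked c x ≡ true
    cover x W-x with lookup C x in x∈C
    ... | true = inj₂ (x , ∈-allFin x , cong₂ _∧_ x∈C (cong (_∨ not (a x x)) (==-refl x)))
    ... | false with adjToAll C x in adjacent
    ...   | true = inj₁ (cong (_∧ true) W-x)
    ...   | false with all-false⇒∃ _ (allFin n) adjacent
    ...     | c , _ , fails = inj₂ (c , ∈-allFin c ,
                cong₂ _∧_ (not-false⇒true (∨-conicalˡ _ _ fails))
                          (trans (cong (λ b → (x == c) ∨ not b) (∨-conicalʳ (not (lookup C c)) _ fails)) (∨-zeroʳ _)))
    blocked-≤ : ∀ c → count (blocked c) (allFin n) ≤ 𝟙 (lookup C c) * D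
    blocked-≤ c rewrite count-∧ˡ (lookup C c) (closedNonNbr a c) (allFin n) with lookup C c in c∈C
    ... | false = z≤n
    ... | true = *-monoʳ-≤ 1 (sparse c (C⊆W c c∈C))
    candidates : 0 < count candidate (allFin n)
    candidates = +-cancelʳ-< (size C * D) 0 _ (begin-strict
      size C * D
        <⟨ small ⟩
      count W (allFin n)
        ≤⟨ count-unionBound W candidate blocked (allFin n) (allFin n) cover ⟩
      count candidate (allFin n) + ∑ (λ c → count (blocked c) (allFin n)) (allFin n)
        ≤⟨ +-monoʳ-≤ _ (∑≤count* (lookup C) _ D (allFin n) blocked-≤) ⟩
      count candidate (allFin n) + size C * D ∎)
      where open ≤-Reasoning
    found = count-witness candidate (allFin n) candidates
    x : Fin n
    x = proj₁ found
    W-x : W x ≡ true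
    W-x = ∧-conicalˡ _ _ (proj₂ found)
    x∉C : lookup C x ≡ false
    x∉C = not-true⇒false (∧-conicalˡ _ _ (∧-conicalʳ (W x) _ (proj₂ found)))
    adj-x : ∀ c → lookup C c ≡ true → a c x ≡ true
    adj-x c c∈C = subst (λ b → (not b ∨ a c x) ≡ true) c∈C
      (all-elim _ (allFin n) (∧-conicalʳ (not (lookup C x)) _ (∧-conicalʳ (W x) _ (proj₂ found))) (∈-allFin c))

  grow : (k : ℕ) → k * D < count W (allFin n) → (j : ℕ) (C : Subset n) → size C + j ≡ k →
    IsClique a C → C ⊆ W → ∃[ C′ ] IsClique a C′ × C′ ⊆ W × size C′ ≡ k × C ⊆ lookup C′
  grow k small zero C |C|≡k clique C⊆W = C , clique , C⊆W , trans (sym (+-identityʳ _)) |C|≡k , λ _ i∈C → i∈C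
  grow k small (suc j) C |C|+j≡k clique C⊆W =
    let C′ , clique′ , C′⊆W , |C′|≡k , C+x⊆C′ = grow k small j (insert C x) |C+x|+j≡k clique+x C+x⊆W
    in C′ , clique′ , C′⊆W , |C′|≡k , λ i i∈C → C+x⊆C′ i (insert-old C x i i∈C)
    where
    |C|<k : size C < k
    |C|<k = subst (size C <_) |C|+j≡k (m<m+n (size C) (s≤s z≤n))
    step = extend C C⊆W (≤-<-trans (*-monoˡ-≤ D (<⇒≤ |C|<k)) small)
    x : Fin n
    x = proj₁ step
    |C+x|+j≡k : size (insert C x) + j ≡ k
    |C+x|+j≡k = trans (cong (_+ j) (size-insert C x (proj₁ (proj₂ (proj₂ step))))) (trans (sym (+-suc _ j)) |C|+j≡k)
    clique+x : IsClique a (insert C x)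
    clique+x = IsClique-insert a symmetric C x clique (proj₂ (proj₂ (proj₂ step)))
    C+x⊆W : insert C x ⊆ W
    C+x⊆W i i∈C+x with insert⁻ C x i i∈C+x
    ... | inj₁ i∈C = C⊆W i i∈C
    ... | inj₂ refl = proj₁ (proj₂ step)

  edge-in-clique : (k : ℕ) → 2 ≤ k → k * D < count W (allFin n) →
    {u v : Fin n} → W u ≡ true → W v ≡ true → u ≢ v → a u v ≡ true →
    ∃[ C ] IsClique a C × size C ≡ k × lookup C u ≡ true × lookup C v ≡ true
  edge-in-clique k 2≤k small {u} {v} W-u W-v u≢v uv∈E =
    let C , clique , _ , |C|≡k , pair⊆C = grow k small (k ∸ 2) (pair u v) |pair|+[k-2]≡k
                                            (IsClique-pair a symmetric uv∈E) pair⊆W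
    in C , clique , |C|≡k , pair⊆C u (pair-fst u v) , pair⊆C v (pair-snd u v)
    where
    |pair|+[k-2]≡k : size (pair u v) + (k ∸ 2) ≡ k
    |pair|+[k-2]≡k = trans (cong (_+ (k ∸ 2)) (size-pair u≢v)) (m+[n∸m]≡n 2≤k)
    pair⊆W : pair u v ⊆ W
    pair⊆W i i∈pair = [ (λ i≡u → subst (λ z → W z ≡ true) (sym i≡u) W-u)
                      , (λ i≡v → subst (λ z → W z ≡ true) (sym i≡v) W-v) ]′ (pair⁻ u v i i∈pair)

-- The vertices of A ∖ B

module _ (r s : ℕ) {n : ℕ} (G : Graph n) where

  A∖B : Fin n → Bool
  A∖B v = inA r G v ∧ not (inB r s G v)

  n∸sizeB≤ : n ∸ sizeB r s G ≤ count (not ∘ inA r G) (allFin n) + count A∖B (allFin n)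
  n∸sizeB≤ = begin
    n ∸ sizeB r s G                              ≡⟨ cong (_∸ sizeB r s G) n≡B+B̄ ⟩
    sizeB r s G + count (not ∘ inB r s G) (allFin n) ∸ sizeB r s G
                                                 ≡⟨ m+n∸m≡n (sizeB r s G) _ ⟩
    count (not ∘ inB r s G) (allFin n)           ≤⟨ count-≤-+ _ (not ∘ inA r G) A∖B (allFin n) outside-A-or-A∖B ⟩
    count (not ∘ inA r G) (allFin n) + count A∖B (allFin n) ∎
    where
    open ≤-Reasoning
    n≡B+B̄ : n ≡ sizeB r s G + count (not ∘ inB r s G) (allFin n)
    n≡B+B̄ = sym (trans (count+count-not (inB r s G) (allFin n)) (length-allFin n))
    outside-A-or-A∖B : ∀ v → not (inB r s G v) ≡ true → not (inA r G v) ≡ true ⊎ A∖B v ≡ true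
    outside-A-or-A∖B v v∉B with inA r G v
    ... | false = inj₁ refl
    ... | true = inj₂ v∉B

  notInB⇒ : {u : Fin n} (S : Subset n) → inA r G u ≡ true → inB r s G u ≡ false →
    isKCopy (s ∸ 1) (adj G) S ≡ true → lookup S u ≡ true →
    ∃[ w ] lookup S w ≡ true × w ≢ u × inA r G w ≡ true
  notInB⇒ {u} S u∈A u∉B copy u∈S = w , w∈S , w≢u , w∈A
    where
    othersOutsideA : Subset n → Bool
    othersOutsideA T = all (λ w → not (lookup T w) ∨ (w == u) ∨ not (inA r G w)) (allFin n)
    no-witness : any (λ T → isKCopy (s ∸ 1) (adj G) T ∧ lookup T u ∧ othersOutsideA T) (allSubsets n) ≡ false
    no-witness = subst (λ b → (b ∧ any (λ T → isKCopy (s ∸ 1) (adj G) T ∧ lookup T u ∧ othersOutsideA T)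
                                       (allSubsets n)) ≡ false)
                       u∈A u∉B
    S-fails : othersOutsideA S ≡ false
    S-fails = subst₂ (λ b c → (b ∧ c ∧ othersOutsideA S) ≡ false) copy u∈S
                (any-false⇒ _ (allSubsets n) no-witness (∈-allSubsets S))
    witness = all-false⇒∃ _ (allFin n) S-fails
    w : Fin n
    w = proj₁ witness
    w-fails : (not (lookup S w) ∨ (w == u) ∨ not (inA r G w)) ≡ false
    w-fails = proj₂ (proj₂ witness)
    w∈S : lookup S w ≡ true
    w∈S = not-false⇒true (∨-conicalˡ _ _ w-fails)
    w-fails′ : ((w == u) ∨ not (inA r G w)) ≡ false
    w-fails′ = ∨-conicalʳ (not (lookup S w)) _ w-fails
    w≢u : w ≢ u
    w≢u = ==-false⇒≢ (∨-conicalˡ _ _ w-fails′)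
    w∈A : inA r G w ≡ true
    w∈A = not-false⇒true (∨-conicalʳ (w == u) _ w-fails′)

  module _ (sat : StronglySat s G) (2≤r : 2 ≤ r) (r<s : r < s) where

    r≤s∸1 : r ≤ s ∸ 1
    r≤s∸1 = ∸-monoˡ-≤ 1 r<s

    copy-remove-endpoint : {u v w : Fin n} (S : Subset n) → isKCopy s (addEdge G u v) S ≡ true →
      lookup S w ≡ true → w ≡ u ⊎ w ≡ v → size (remove S w) ≡ s ∸ 1 × IsClique (adj G) (remove S w)
    copy-remove-endpoint {u} {v} {w} S copy w∈S w∈uv =
      cong (_∸ 1) (trans (sym (size-remove S w w∈S)) (proj₁ (isKCopy⁻ (addEdge G u v) S copy))) ,
      IsClique-addEdge-remove G S (proj₂ (isKCopy⁻ (addEdge G u v) S copy)) w∈uv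

    nonEdge-path : {u v : Fin n} → inA r G u ≡ true → inB r s G u ≡ false → u ≢ v → adj G u v ≡ false →
      ∃[ w ] inE1 r G u w ≡ true × inA r G w ≡ true × inE1 r G w v ≡ true
    nonEdge-path {u} {v} u∈A u∉B u≢v uv∉E = w , uw∈E1 , w∈A , wv∈E1
      where
      saturating = sat u v u≢v uv∉E
      S : Subset n
      S = proj₁ saturating
      copy : isKCopy s (addEdge G u v) S ≡ true
      copy = Equivalence.to T-≡ (proj₁ (proj₂ saturating))
      u∈S : lookup S u ≡ true
      u∈S = proj₁ (proj₂ (proj₂ saturating))
      v∈S : lookup S v ≡ true
      v∈S = proj₂ (proj₂ (proj₂ saturating))
      S-v = copy-remove-endpoint S copy v∈S (inj₂ refl)
      S-u = copy-remove-endpoint S copy u∈S (inj₁ refl)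
      u∈S-v : lookup (remove S v) u ≡ true
      u∈S-v = remove⁺ S u∈S u≢v
      other = notInB⇒ (remove S v) u∈A u∉B (isKCopy⁺ (adj G) (remove S v) (proj₁ S-v) (proj₂ S-v)) u∈S-v
      w : Fin n
      w = proj₁ other
      w∈S-v : lookup (remove S v) w ≡ true
      w∈S-v = proj₁ (proj₂ other)
      w≢u : w ≢ u
      w≢u = proj₁ (proj₂ (proj₂ other))
      w∈A : inA r G w ≡ true
      w∈A = proj₂ (proj₂ (proj₂ other))
      uw∈E1 : inE1 r G u w ≡ true
      uw∈E1 = clique-edge-inE1 r G 2≤r (remove S v) (proj₂ S-v) (subst (r ≤_) (sym (proj₁ S-v)) r≤s∸1)
                u∈S-v w∈S-v (w≢u ∘ sym)
      wv∈E1 : inE1 r G w v ≡ true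
      wv∈E1 = clique-edge-inE1 r G 2≤r (remove S u) (proj₂ S-u) (subst (r ≤_) (sym (proj₁ S-u)) r≤s∸1)
                (remove⁺ S (remove⊆ S v w w∈S-v) w≢u) (remove⁺ S v∈S (u≢v ∘ sym)) (remove-≢ S v w∈S-v)

    closedNonNbr-≤ : (Q : ℕ) → (∀ v → inA r G v ≡ true → degG1 r G v ≤ Q) →
      {u : Fin n} → inA r G u ≡ true → inB r s G u ≡ false →
      count (closedNonNbr (adj G) u) (allFin n) ≤ suc (Q * Q)
    closedNonNbr-≤ Q A-deg {u} u∈A u∉B = begin
      count (closedNonNbr (adj G) u) (allFin n)
        ≤⟨ count-unionBound _ (_== u) through (allFin n) (allFin n) cover ⟩
      count (_== u) (allFin n) + ∑ (λ w → count (through w) (allFin n)) (allFin n)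
        ≤⟨ +-mono-≤ (≤-reflexive (count-== u)) (∑≤count* (inE1 r G u) _ Q (allFin n) paths-through) ⟩
      1 + degG1 r G u * Q
        ≤⟨ +-monoʳ-≤ 1 (*-monoˡ-≤ Q (A-deg u u∈A)) ⟩
      suc (Q * Q) ∎
      where
      open ≤-Reasoning
      through : Fin n → Fin n → Bool
      through w v = (inE1 r G u w ∧ inA r G w) ∧ inE1 r G w v
      cover : ∀ v → closedNonNbr (adj G) u v ≡ true → (v == u) ≡ true ⊎ ∃[ w ] w ∈ allFin n × through w v ≡ true
      cover v h with v == u in v=u
      ... | true = inj₁ refl
      ... | false =
        let w , uw∈E1 , w∈A , wv∈E1 = nonEdge-path u∈A u∉B (==-false⇒≢ v=u ∘ sym) (not-true⇒false h)
        in inj₂ (w , ∈-allFin w , cong₂ _∧_ (cong₂ _∧_ uw∈E1 w∈A) wv∈E1)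
      paths-through : ∀ w → count (through w) (allFin n) ≤ 𝟙 (inE1 r G u w) * Q
      paths-through w rewrite count-∧ˡ (inE1 r G u w ∧ inA r G w) (inE1 r G w) (allFin n)
        with inE1 r G u w | inA r G w in w∈A
      ... | false | _ = z≤n
      ... | true | false = z≤n
      ... | true | true = *-monoʳ-≤ 1 (A-deg w w∈A)

    count-A∖B-≤ : (Q : ℕ) → (∀ v → inA r G v ≡ true → degG1 r G v ≤ Q) →
      count A∖B (allFin n) ≤ r * suc (Q * Q) + (suc (Q * Q) + Q)
    count-A∖B-≤ Q A-deg = ≮⇒≥ too-many
      where
      sparse : ∀ c → A∖B c ≡ true → count (closedNonNbr (adj G) c) (allFin n) ≤ suc (Q * Q)
      sparse c c∈A∖B =
        closedNonNbr-≤ Q A-deg (∧-conicalˡ _ _ c∈A∖B) (not-true⇒false (∧-conicalʳ (inA r G c) _ c∈A∖B))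
      open Greedy (adj G) (Graph.sym G) A∖B (suc (Q * Q)) sparse
      too-many : ¬ (r * suc (Q * Q) + (suc (Q * Q) + Q) < count A∖B (allFin n))
      too-many big = <⇒≱ (≤-<-trans (m≤n+m _ _) big) (begin
        count A∖B (allFin n)
          ≤⟨ count-≤-+ A∖B (λ v → A∖B v ∧ adj G u v) (closedNonNbr (adj G) u) (allFin n) nbr-or-not ⟩
        count (λ v → A∖B v ∧ adj G u v) (allFin n) + count (closedNonNbr (adj G) u) (allFin n)
          ≤⟨ +-mono-≤ (count-mono-≤ _ (inE1 r G u) (allFin n) nbr-in-E1) (sparse u u∈A∖B) ⟩
        degG1 r G u + suc (Q * Q)
          ≤⟨ +-monoˡ-≤ _ (A-deg u (∧-conicalˡ _ _ u∈A∖B)) ⟩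
        Q + suc (Q * Q)
          ≡⟨ +-comm Q _ ⟩
        suc (Q * Q) + Q ∎)
        where
        open ≤-Reasoning
        some = count-witness A∖B (allFin n) (≤-<-trans z≤n big)
        u : Fin n
        u = proj₁ some
        u∈A∖B : A∖B u ≡ true
        u∈A∖B = proj₂ some
        nbr-or-not : ∀ v → A∖B v ≡ true → (A∖B v ∧ adj G u v) ≡ true ⊎ closedNonNbr (adj G) u v ≡ true
        nbr-or-not v v∈A∖B with adj G u v
        ... | true = inj₁ (cong (_∧ true) v∈A∖B)
        ... | false = inj₂ (∨-zeroʳ (v == u))
        nbr-in-E1 : ∀ v → (A∖B v ∧ adj G u v) ≡ true → inE1 r G u v ≡ true
        nbr-in-E1 v h =
          let C , clique , |C|≡r , u∈C , v∈C = edge-in-clique r 2≤r (≤-<-trans (m≤m+n _ _) big)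
                                                  u∈A∖B (∧-conicalˡ _ _ h) u≢v uv∈E
          in inE1⁺ r G C clique |C|≡r u∈C v∈C u≢v
          where
          uv∈E : adj G u v ≡ true
          uv∈E = ∧-conicalʳ (A∖B v) _ h
          u≢v : u ≢ v
          u≢v refl = contradiction (trans (sym (Graph.irrefl G u)) uv∈E) λ ()

-- Extremal graphs

countK-extremal-≤ : (r t : ℕ) {n : ℕ} (G : Graph n) → t ≤ n → SsatExtremal r (t + 2) G →
  countK r G ≤ suc n * 2 ^ suc t
countK-extremal-≤ r t {n} G t≤n (_ , minimal) = begin
  countK r G                 ≤⟨ minimal completeSplit completeSplit-stronglySat ⟩
  countK r completeSplit     ≤⟨ countK-completeSplit r ⟩
  2 ^ t + n * 2 ^ suc t      ≤⟨ +-monoˡ-≤ (n * 2 ^ suc t) (^-monoʳ-≤ 2 (n≤1+n t)) ⟩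
  suc n * 2 ^ suc t          ∎
  where
  open ≤-Reasoning
  open CompleteSplit t t≤n

cubeRoot : ∀ n → ∃[ Q ] Q ^ 3 ≤ n × n < suc Q ^ 3
cubeRoot zero = 0 , z≤n , s≤s z≤n
cubeRoot (suc n) with cubeRoot n
... | Q , Q³≤n , n<[Q+1]³ with suc Q ^ 3 ≤? suc n
...   | yes [Q+1]³≤n+1 = suc Q , [Q+1]³≤n+1 , ≤-<-trans n<[Q+1]³ (^-monoˡ-< 3 (n<1+n (suc Q)))
...   | no [Q+1]³≰n+1 = Q , ≤-trans Q³≤n (n≤1+n n) , ≰⇒> [Q+1]³≰n+1

fraction-bound : (m b x y K : ℕ) → m ∸ b ≤ x + y → 2 * K * x ≤ m → 2 * K * y ≤ m → K * (m ∸ b) ≤ m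
fraction-bound m b x y K m∸b≤x+y 2Kx≤m 2Ky≤m = *-cancelˡ-≤ 2 (begin
  2 * (K * (m ∸ b))          ≤⟨ *-monoʳ-≤ 2 (*-monoʳ-≤ K m∸b≤x+y) ⟩
  2 * (K * (x + y))          ≡⟨ distribute K x y ⟩
  2 * K * x + 2 * K * y      ≤⟨ +-mono-≤ 2Kx≤m 2Ky≤m ⟩
  m + m                      ≡⟨ cong (m +_) (+-identityʳ m) ⟨
  2 * m                      ∎)
  where
  open ≤-Reasoning
  distribute : ∀ K x y → 2 * (K * (x + y)) ≡ 2 * K * x + 2 * K * y
  distribute = solve-∀

outsideA-small : (r t : ℕ) {n : ℕ} (G : Graph n) (K Q : ℕ) → SsatExtremal r (t + 2) G → t ≤ n → 1 ≤ n →
  Q ^ 3 ≤ n → 4 * K * suc (2 ^ suc t * (r * r)) ≤ Q → 2 * K * count (not ∘ inA r G) (allFin n) ≤ n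
outsideA-small r t {n} G K Q extremal t≤n 1≤n Q³≤n 4KD≤Q = *-cancelʳ-≤ (2 * K * x) n (2 * D) (begin
  2 * K * x * (2 * D)          ≡⟨ rearrange K x D ⟩
  x * (4 * K * D)              ≤⟨ *-monoʳ-≤ x (≤-trans 4KD≤Q (n≤1+n Q)) ⟩
  x * suc Q                    ≤⟨ count-notA-≤ r G Q³≤n ⟩
  countK r G * (r * r)         ≤⟨ *-monoˡ-≤ (r * r) (countK-extremal-≤ r t G t≤n extremal) ⟩
  suc n * 2 ^ suc t * (r * r)  ≡⟨ *-assoc (suc n) (2 ^ suc t) (r * r) ⟩
  suc n * C                    ≤⟨ *-mono-≤ (+-monoˡ-≤ n 1≤n) (n≤1+n C) ⟩
  (n + n) * D                  ≡⟨ double n D ⟩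
  n * (2 * D)                  ∎)
  where
  open ≤-Reasoning
  x = count (not ∘ inA r G) (allFin n)
  C = 2 ^ suc t * (r * r)
  D = suc C
  rearrange : ∀ K x D → 2 * K * x * (2 * D) ≡ x * (4 * K * D)
  rearrange = solve-∀
  double : ∀ n D → (n + n) * D ≡ n * (2 * D)
  double = solve-∀

A∖B-small : (r s : ℕ) {n : ℕ} (G : Graph n) (k Q : ℕ) → StronglySat s G → 2 ≤ r → r < s →
  Q ^ 3 ≤ n → n < suc Q ^ 3 → 2 * suc k * (2 * r + 3) ≤ Q → 2 * suc k * count (A∖B r s G) (allFin n) ≤ n
A∖B-small r s {n} G k Q sat 2≤r r<s Q³≤n n<[Q+1]³ 2K[2r+3]≤Q = begin
  2 * K * count (A∖B r s G) (allFin n)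
    ≤⟨ *-monoʳ-≤ (2 * K) (count-A∖B-≤ r s G sat 2≤r r<s Q (inA⇒deg≤ r G n<[Q+1]³)) ⟩
  2 * K * (r * suc (Q * Q) + (suc (Q * Q) + Q))
    ≤⟨ *-monoʳ-≤ (2 * K) (+-mono-≤ (*-monoʳ-≤ r 1+Q²≤2Q²) (+-mono-≤ 1+Q²≤2Q² Q≤Q²)) ⟩
  2 * K * (r * (2 * (Q * Q)) + (2 * (Q * Q) + Q * Q))
    ≡⟨ collect K r (Q * Q) ⟩
  2 * K * (2 * r + 3) * (Q * Q)
    ≤⟨ *-monoˡ-≤ (Q * Q) 2K[2r+3]≤Q ⟩
  Q * (Q * Q)
    ≡⟨ cong (λ m → Q * (Q * m)) (*-identityʳ Q) ⟨
  Q ^ 3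
    ≤⟨ Q³≤n ⟩
  n ∎
  where
  open ≤-Reasoning
  K = suc k
  1≤Q : 1 ≤ Q
  1≤Q = ≤-trans (*-mono-≤ {1} {2 * K} {1} {2 * r + 3} (s≤s z≤n) (≤-trans (s≤s z≤n) (m≤n+m 3 (2 * r)))) 2K[2r+3]≤Q
  Q≤Q² : Q ≤ Q * Q
  Q≤Q² = m≤m*n Q Q {{>-nonZero 1≤Q}}
  1+Q²≤2Q² : suc (Q * Q) ≤ 2 * (Q * Q)
  1+Q²≤2Q² = subst (suc (Q * Q) ≤_) (cong (Q * Q +_) (sym (+-identityʳ (Q * Q))))
               (+-monoˡ-≤ (Q * Q) (≤-trans 1≤Q Q≤Q²))
  collect : ∀ K r P → 2 * K * (r * (2 * P) + (2 * P + P)) ≡ 2 * K * (2 * r + 3) * P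
  collect = solve-∀

lemma2p2 : (r s : ℕ) → 2 ≤ r → r < s →
    (k : ℕ) → Σ ℕ λ N → (n : ℕ) → N ≤ n →
    (G : Graph n) → SsatExtremal r s G →
    suc k * (n ∸ sizeB r s G) ≤ n
lemma2p2 r s 2≤r r<s k = suc (M ^ 3 + t) , bound
  where
  t = s ∸ 2
  -- M³ ≤ n puts the cube root of n above both thresholds below; the summand t makes room for the
  -- core of the comparison graph.
  M = 4 * suc k * suc (2 ^ suc t * (r * r)) + 2 * suc k * (2 * r + 3)
  bound : (n : ℕ) → suc (M ^ 3 + t) ≤ n → (G : Graph n) → SsatExtremal r s G → suc k * (n ∸ sizeB r s G) ≤ n
  bound n N≤n G extremal with cubeRoot n
  ... | Q , Q³≤n , n<[Q+1]³ = fraction-bound n (sizeB r s G) _ _ (suc k) (n∸sizeB≤ r s G)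
    (outsideA-small r t G (suc k) Q (subst (λ s → SsatExtremal r s G) s≡t+2 extremal) t≤n 1≤n Q³≤n
      (≤-trans (m≤m+n _ (2 * suc k * (2 * r + 3))) M≤Q))
    (A∖B-small r s G k Q (proj₁ extremal) 2≤r r<s Q³≤n n<[Q+1]³
      (≤-trans (m≤n+m _ (4 * suc k * suc (2 ^ suc t * (r * r)))) M≤Q))
    where
    s≡t+2 : s ≡ t + 2
    s≡t+2 = sym (m∸n+n≡m (≤-trans 2≤r (<⇒≤ r<s)))
    t≤n : t ≤ n
    t≤n = ≤-trans (m≤n+m t _) (<⇒≤ N≤n)
    1≤n : 1 ≤ n
    1≤n = ≤-trans (s≤s z≤n) N≤n
    M≤Q : M ≤ Q
    M≤Q = ≮⇒≥ λ Q<M → <⇒≱ n<[Q+1]³ (≤-trans (^-monoˡ-≤ 3 Q<M) (≤-trans (m≤m+n _ t) (<⇒≤ N≤n)))
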